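{- Let $G$ be the bipartite graph on players and fat resources described below, let $M$ be a maximum matching of $G$, let $S \subseteq \overline{P}_M$, let $T \subseteq P$, and let $p \in P$. If $f_M(S, T\cup\{p\}) = f_M(S,T)+1$, then for every $T' \subseteq T$, $f_M(S, T'\cup\{p\}) = f_M(S,T')+1$.
   Context: Let $P$ be a set of players and $R_f$ a set of (fat) resources, and let $G$ be a bipartite graph with vertex set $P \cup R_f$ whose edges join players to resources. For a maximum matching $M$ of $G$, let $G_M$ be the directed graph obtained from $G$ by orienting each edge $(p,r)$ from $r$ to $p$ if $(p,r)\in M$ and from $p$ to $r$ otherwise. Let $\overline{P}_M \subseteq P$ be the set of players not matched by $M$. For $S \subseteq \overline{P}_M$ and $T \subseteq P$, $f_M(S,T)$ denotes the maximum number of pairwise vertex-disjoint directed paths in $G_M$ each starting at a vertex of $S$ and ending at a vertex of $T$; a single vertex of $S \cap T$ counts as a (trivial) path. -}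

module Defs where

open import Data.Nat using (ℕ; zero; suc; _+_; _≤_)
open import Data.Bool using (Bool; true; false; if_then_else_)
open import Data.Fin using (Fin)
open import Data.Fin.Subset using (Subset; _∈_)
open import Data.Sum using (_⊎_; inj₁; inj₂)
open import Data.Product using (Σ; _×_; _,_)
open import Data.List using (List; []; _∷_; length; concatMap)
open import Data.List.Relation.Unary.Unique.Propositional using (Unique)
open import Relation.Binary.PropositionalEquality using (_≡_)

sumFin : ∀ {n} → (Fin n → ℕ) → ℕ
sumFin {zero} f = 0
sumFin {suc n} f = f Fin.zero + sumFin (λ i → f (Fin.suc i))

count : ∀ {n} → (Fin n → Bool) → ℕ
count f = sumFin (λ i → if f i then 1 else 0)

-- A (simple) bipartite graph between np players (Fin np) and nr fat
-- resources (Fin nr), given by its adjacency relation.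
Graph : ℕ → ℕ → Set
Graph np nr = Fin np → Fin nr → Bool

EdgeSet : ℕ → ℕ → Set
EdgeSet = Graph

record IsMatching {np nr : ℕ} (G : Graph np nr) (M : EdgeSet np nr) : Set where
  field
    sub      : ∀ p r → M p r ≡ true → G p r ≡ true
    playerUq : ∀ p r r' → M p r ≡ true → M p r' ≡ true → r ≡ r'
    resUq    : ∀ p p' r → M p r ≡ true → M p' r ≡ true → p ≡ p'

size : ∀ {np nr} → EdgeSet np nr → ℕ
size M = sumFin (λ p → count (M p))

IsMaximumMatching : ∀ {np nr} → Graph np nr → EdgeSet np nr → Set
IsMaximumMatching G M =
  IsMatching G M × (∀ M' → IsMatching G M' → size M' ≤ size M)

Unmatched : ∀ {np nr} → EdgeSet np nr → Fin np → Set
Unmatched M p = ∀ r → M p r ≡ false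

Vertex : ℕ → ℕ → Set
Vertex np nr = Fin np ⊎ Fin nr

data Arc {np nr : ℕ} (G : Graph np nr) (M : EdgeSet np nr)
     : Vertex np nr → Vertex np nr → Set where
  fwd : ∀ {p r} → G p r ≡ true → M p r ≡ false → Arc G M (inj₁ p) (inj₂ r)
  bwd : ∀ {p r} → G p r ≡ true → M p r ≡ true → Arc G M (inj₂ r) (inj₁ p)

data Walk {np nr : ℕ} (G : Graph np nr) (M : EdgeSet np nr)
     : Vertex np nr → Vertex np nr → Set where
  here : ∀ v → Walk G M v v
  step : ∀ {u v w} → Arc G M u v → Walk G M v w → Walk G M u w

verts : ∀ {np nr} {G : Graph np nr} {M : EdgeSet np nr} {u v} →
        Walk G M u v → List (Vertex np nr)
verts (here v) = v ∷ []
verts (step {u} a w) = u ∷ verts w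

record STPath {np nr : ℕ} (G : Graph np nr) (M : EdgeSet np nr)
              (S T : Subset np) : Set where
  constructor stpath
  field
    src  : Fin np
    tgt  : Fin np
    srcS : src ∈ S
    tgtT : tgt ∈ T
    walk : Walk G M (inj₁ src) (inj₁ tgt)

pathVerts : ∀ {np nr} {G : Graph np nr} {M : EdgeSet np nr} {S T} →
            STPath G M S T → List (Vertex np nr)
pathVerts P = verts (STPath.walk P)

-- a family of pairwise vertex-disjoint directed paths (each path simple):
-- all vertices of all the paths, listed together, are distinct
Disjoint : ∀ {np nr} {G : Graph np nr} {M : EdgeSet np nr} {S T} →
           List (STPath G M S T) → Set
Disjoint Ps = Unique (concatMap pathVerts Ps)

-- f_M(S,T) = k : k is the maximum number of pairwise vertex-disjoint
-- directed S–T paths in G_M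
IsFM : ∀ {np nr} → Graph np nr → EdgeSet np nr → Subset np → Subset np → ℕ → Set
IsFM G M S T k =
  (Σ (List (STPath G M S T)) λ Ps → Disjoint Ps × length Ps ≡ k)
  × (∀ (Ps : List (STPath G M S T)) → Disjoint Ps → length Ps ≤ k)

{-# OPTIONS --safe #-}

-- For fixed S, T ↦ f_M(S, T) is the rank function of a gammoid, hence submodular; neither the
-- matching hypotheses nor the bipartite structure play a role. Submodularity comes from
-- Menger's theorem (the maximum number of disjoint A–B paths equals the minimum size of a
-- vertex set meeting every A–B walk), proved by induction on the arcs, combined with
-- uncrossing: separators Z₁ of A from X₁ and Z₂ of A from X₂ rearrange into separators of A
-- from X₁ ∪ X₂ and from X₁ ∩ X₂ of total size |Z₁| + |Z₂|. With X₁ = T' ∪ {p} and X₂ = T this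
-- gives f(T ∪ {p}) + f(T') ≤ f(T' ∪ {p}) + f(T), so f(T') + 1 ≤ f(T' ∪ {p}); conversely a
-- minimum separator for T' together with p separates S from T' ∪ {p}. The reasoning is
-- classical, carried out under double negation, which is harmless because the conclusion is
-- a decidable equation between natural numbers.

module Submission where

open import Algebra.Properties.CommutativeSemigroup using (interchange)
open import Data.Bool using (true; false)
open import Data.Bool.Properties using () renaming (_≟_ to _≟ᵇ_)
open import Data.Empty using (⊥; ⊥-elim)
open import Data.Fin using (Fin; inject≤; punchOut) renaming (zero to fzero; suc to fsuc)
open import Data.Fin.Properties
  using (¬Fin0; any?; injective⇒≤; punchOut-injective; inject≤-injective)
  renaming (_≟_ to _≟ᶠ_)
open import Data.List using (List; []; _∷_; _++_; _∷ʳ_; length; lookup; map; concat; concatMap; filter; tabulate; allFin; cartesianProduct)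
open import Data.List.Properties using (length-++; ++-assoc; length-map; length-tabulate; map-tabulate; concatMap-cong; concatMap-map)
open import Data.List.Relation.Unary.All as All using (All; []; _∷_)
import Data.List.Relation.Unary.All.Properties as All
open import Data.List.Relation.Unary.AllPairs using ([]; _∷_)
import Data.List.Relation.Unary.AllPairs.Properties as AllPairs
open import Data.List.Relation.Unary.Any as Any using (Any; here; there; index)
open import Data.List.Relation.Unary.Any.Properties using (lookup-index)
open import Data.List.Relation.Unary.Unique.Propositional using (Unique)
import Data.List.Relation.Unary.Unique.Propositional.Properties as Unique
open import Data.Nat using (ℕ; zero; suc; _+_; _≤_; _<_; s≤s; _≤?_)
open import Data.Nat.Properties
  using (module ≤-Reasoning; ≤-trans; ≤-antisym; <⇒≱; ≤-pred; <-irrefl; ≤∧≢⇒<; ≰⇒>; +-mono-≤; +-comm; +-suc; +-cancelʳ-≤; +-commutativeSemigroup)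
open import Data.Product using (Σ-syntax; ∃; ∃-syntax; ∃₂; _×_; _,_; proj₁; proj₂)
open import Data.Sum as Sum using (_⊎_; inj₁; inj₂; [_,_])
open import Data.Sum.Properties using (≡-dec; inj₁-injective; inj₂-injective)
open import Effect.Monad using (RawMonad)
open import Function using (_∘_; Injective)
open import Level using (0ℓ)
open import Relation.Binary.Definitions using (DecidableEquality)
open import Relation.Binary.PropositionalEquality
  using (_≡_; _≢_; refl; sym; trans; cong; cong₂; subst; module ≡-Reasoning)
open import Relation.Nullary using (¬_; Dec; yes; no; contradiction)
open import Relation.Nullary.Decidable using (map′; decidable-stable; ¬¬-excluded-middle; ¬?; _×-dec_; _⊎-dec_)
open import Relation.Nullary.Negation using (¬¬-Monad)

open RawMonad (¬¬-Monad {0ℓ}) using (pure; _>>=_; _<$>_)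

open import Defs using (Graph; EdgeSet; Vertex; Arc; fwd; bwd; STPath; stpath; pathVerts; IsFM)
  renaming (Walk to Walkᴹ; here to stopᴹ; step to stepᴹ; verts to vertsᴹ; Disjoint to DisjointPaths)

Fin-injective⇒surjective : ∀ {n} (f : Fin n → Fin n) → Injective _≡_ _≡_ f → ∀ y → ∃[ x ] f x ≡ y
Fin-injective⇒surjective {suc n} f f-inj y with any? (λ x → f x ≟ᶠ y)
... | yes hit = hit
... | no miss = contradiction (injective⇒≤ punchOut-inj) (<-irrefl refl)
  where
  y≢f : ∀ x → y ≢ f x
  y≢f x y≡fx = miss (x , sym y≡fx)
  punchOut-inj : Injective _≡_ _≡_ (λ x → punchOut (y≢f x))
  punchOut-inj eq = f-inj (punchOut-injective (y≢f _) (y≢f _) eq)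

module Lists {A : Set} where

  open import Data.List.Membership.Propositional using (_∈_)
  open import Data.List.Membership.Propositional.Properties using (∈-++⁺ˡ; ∈-++⁺ʳ; ∈-lookup)
  open import Data.List.Relation.Binary.Disjoint.Propositional using (Disjoint)
  open import Data.List.Relation.Binary.Subset.Propositional using (_⊆_)
  open import Relation.Unary using (Pred; Decidable)
  open import Relation.Unary.Properties using (∁?)

  private variable
    v x y : A
    xs ys : List A
    P : Pred A 0ℓ
    k : ℕ

  Unique-++⁻ˡ : ∀ xs → Unique (xs ++ ys) → Unique xs
  Unique-++⁻ˡ []       _           = []
  Unique-++⁻ˡ (x ∷ xs) (x∉ ∷ uniq) = All.++⁻ˡ xs x∉ ∷ Unique-++⁻ˡ xs uniq

  Unique-++⁻ʳ : ∀ xs → Unique (xs ++ ys) → Unique ys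
  Unique-++⁻ʳ []       uniq       = uniq
  Unique-++⁻ʳ (x ∷ xs) (_ ∷ uniq) = Unique-++⁻ʳ xs uniq

  Unique-++⁻-disjoint : ∀ xs → Unique (xs ++ ys) → Disjoint xs ys
  Unique-++⁻-disjoint (x ∷ xs) (x∉ ∷ _)    (here refl , v∈ys) = All.lookup (All.++⁻ʳ xs x∉) v∈ys refl
  Unique-++⁻-disjoint (x ∷ xs) (_  ∷ uniq) (there v∈xs , v∈ys) = Unique-++⁻-disjoint xs uniq (v∈xs , v∈ys)

  Unique-∷ʳ : ∀ xs → Unique (xs ++ ys) → y ∈ ys → Unique (xs ∷ʳ y)
  Unique-∷ʳ xs uniq y∈ys = Unique.++⁺ (Unique-++⁻ˡ xs uniq) ([] ∷ [])
    λ { (v∈xs , here refl) → Unique-++⁻-disjoint xs uniq (v∈xs , y∈ys) }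

  lookup-injective : Unique xs → ∀ i j → lookup xs i ≡ lookup xs j → i ≡ j
  lookup-injective {_ ∷ _} _           fzero    fzero    _  = refl
  lookup-injective {_ ∷ _} (x∉ ∷ _)    fzero    (fsuc j) eq = contradiction eq (All.lookup x∉ (∈-lookup j))
  lookup-injective {_ ∷ _} (x∉ ∷ _)    (fsuc i) fzero    eq = contradiction (sym eq) (All.lookup x∉ (∈-lookup i))
  lookup-injective {_ ∷ _} (_  ∷ uniq) (fsuc i) (fsuc j) eq = cong fsuc (lookup-injective uniq i j eq)

  length-filter-∁ : (P? : Decidable P) → ∀ xs → length (filter P? xs) + length (filter (∁? P?) xs) ≡ length xs
  length-filter-∁ P? []       = refl
  length-filter-∁ P? (x ∷ xs) with P? x
  ... | yes _ = cong suc (length-filter-∁ P? xs)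
  ... | no _  = trans (+-suc _ _) (cong suc (length-filter-∁ P? xs))

  index-injective : (x∈ : x ∈ xs) (y∈ : y ∈ xs) → index x∈ ≡ index y∈ → x ≡ y
  index-injective {xs = xs} x∈ y∈ eq =
    trans (lookup-index x∈) (trans (cong (lookup xs) eq) (sym (lookup-index y∈)))

  injective⇒onto : ∀ xs → length xs ≡ k → (f : Fin k → A) → (∀ i → f i ∈ xs) → Injective _≡_ _≡_ f →
                   v ∈ xs → ∃[ i ] f i ≡ v
  injective⇒onto xs refl f f∈ f-inj v∈ =
    let i , same-index = Fin-injective⇒surjective (index ∘ f∈) (f-inj ∘ index-injective _ _) (index v∈)
    in i , index-injective (f∈ i) v∈ same-index

  module _ {C : Set} (f : C → List A) where

    concatMap-lookup⊆ : ∀ cs i → f (lookup cs i) ⊆ concatMap f cs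
    concatMap-lookup⊆ (c ∷ cs) fzero    v∈ = ∈-++⁺ˡ v∈
    concatMap-lookup⊆ (c ∷ cs) (fsuc i) v∈ = ∈-++⁺ʳ (f c) (concatMap-lookup⊆ cs i v∈)

    concatMap-unique⁻ : ∀ cs → Unique (concatMap f cs) → ∀ i → Unique (f (lookup cs i))
    concatMap-unique⁻ (c ∷ cs) uniq fzero    = Unique-++⁻ˡ (f c) uniq
    concatMap-unique⁻ (c ∷ cs) uniq (fsuc i) = concatMap-unique⁻ cs (Unique-++⁻ʳ (f c) uniq) i

    concatMap-disjoint⁻ : ∀ cs → Unique (concatMap f cs) →
                          ∀ {i j} → i ≢ j → Disjoint (f (lookup cs i)) (f (lookup cs j))
    concatMap-disjoint⁻ (c ∷ cs) uniq {fzero}  {fzero}  i≢j = contradiction refl i≢j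
    concatMap-disjoint⁻ (c ∷ cs) uniq {fzero}  {fsuc j} _ (v∈i , v∈j) =
      Unique-++⁻-disjoint (f c) uniq (v∈i , concatMap-lookup⊆ cs j v∈j)
    concatMap-disjoint⁻ (c ∷ cs) uniq {fsuc i} {fzero}  _ (v∈i , v∈j) =
      Unique-++⁻-disjoint (f c) uniq (v∈j , concatMap-lookup⊆ cs i v∈i)
    concatMap-disjoint⁻ (c ∷ cs) uniq {fsuc i} {fsuc j} i≢j =
      concatMap-disjoint⁻ cs (Unique-++⁻ʳ (f c) uniq) (i≢j ∘ cong fsuc)

module Linkages {V : Set} (_≟_ : DecidableEquality V) where

  open import Data.List.Membership.Propositional using (_∈_; _∉_; lose)
  open import Data.List.Membership.Propositional.Properties
    using (∈-++⁺ˡ; ∈-++⁺ʳ; ∈-++⁻; ∈-lookup; ∈-filter⁺)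
  open import Data.List.Membership.DecPropositional _≟_ using (_∈?_)
  open import Data.List.Relation.Binary.Disjoint.Propositional using (Disjoint)
  open import Data.List.Relation.Binary.Subset.Propositional using (_⊆_)
  open import Relation.Unary using (Pred; ∁; Decidable; _∪_; _∩_; ｛_｝) renaming (_⊆_ to _⇒_)
  open import Relation.Unary.Properties using (∁?)
  open Lists

  private variable
    a b c s t v v′ x y : V
    xs ys Z : List V
    A B X Y : Pred V 0ℓ
    k : ℕ

  -- Walks in a digraph given by its list of edges

  Edges : Set
  Edges = List (V × V)

  infixr 5 _◅_ _◅◅_

  data Walk (E : Edges) : V → V → Set where
    stop : ∀ a → Walk E a a
    _◅_  : ∀ {a b c} → (a , b) ∈ E → Walk E b c → Walk E a c

  private variable
    E : Edges

  verts : Walk E a b → List V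
  verts (stop a)      = a ∷ []
  verts (_◅_ {a} _ w) = a ∷ verts w

  initVerts : Walk E a b → List V
  initVerts (stop _)      = []
  initVerts (_◅_ {a} _ w) = a ∷ initVerts w

  tailVerts : Walk E a b → List V
  tailVerts (stop _) = []
  tailVerts (_ ◅ w)  = verts w

  _◅◅_ : Walk E a b → Walk E b c → Walk E a c
  stop _  ◅◅ w₂ = w₂
  (e ◅ w₁) ◅◅ w₂ = e ◅ (w₁ ◅◅ w₂)

  verts≡initVerts∷ʳ : (w : Walk E a b) → verts w ≡ initVerts w ∷ʳ b
  verts≡initVerts∷ʳ (stop _) = refl
  verts≡initVerts∷ʳ (e ◅ w)  = cong (_ ∷_) (verts≡initVerts∷ʳ w)

  verts≡∷tailVerts : (w : Walk E a b) → verts w ≡ a ∷ tailVerts w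
  verts≡∷tailVerts (stop _) = refl
  verts≡∷tailVerts (e ◅ w)  = refl

  verts-◅◅ : (w₁ : Walk E a b) (w₂ : Walk E b c) → verts (w₁ ◅◅ w₂) ≡ initVerts w₁ ++ verts w₂
  verts-◅◅ (stop _) w₂ = refl
  verts-◅◅ (e ◅ w₁) w₂ = cong (_ ∷_) (verts-◅◅ w₁ w₂)

  first∈verts : (w : Walk E a b) → a ∈ verts w
  first∈verts (stop _) = here refl
  first∈verts (e ◅ w)  = here refl

  last∈verts : (w : Walk E a b) → b ∈ verts w
  last∈verts (stop _) = here refl
  last∈verts (e ◅ w)  = there (last∈verts w)

  initVerts⊆verts : (w : Walk E a b) → initVerts w ⊆ verts w
  initVerts⊆verts w v∈ = subst (_ ∈_) (sym (verts≡initVerts∷ʳ w)) (∈-++⁺ˡ v∈)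

  tailVerts⊆verts : (w : Walk E a b) → tailVerts w ⊆ verts w
  tailVerts⊆verts w v∈ = subst (_ ∈_) (sym (verts≡∷tailVerts w)) (there v∈)

  ∈-verts⁻ʳ : (w : Walk E a b) → v ∈ verts w → v ∈ initVerts w ⊎ v ≡ b
  ∈-verts⁻ʳ w v∈ with ∈-++⁻ (initVerts w) (subst (_ ∈_) (verts≡initVerts∷ʳ w) v∈)
  ... | inj₁ v∈init     = inj₁ v∈init
  ... | inj₂ (here v≡b) = inj₂ v≡b

  ∈-verts⁻ˡ : (w : Walk E a b) → v ∈ verts w → v ≡ a ⊎ v ∈ tailVerts w
  ∈-verts⁻ˡ w v∈ with subst (_ ∈_) (verts≡∷tailVerts w) v∈
  ... | here v≡a    = inj₁ v≡a
  ... | there v∈tail = inj₂ v∈tail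

  ∈-◅◅⁻ : (w₁ : Walk E a b) (w₂ : Walk E b c) → v ∈ verts (w₁ ◅◅ w₂) → v ∈ initVerts w₁ ⊎ v ∈ verts w₂
  ∈-◅◅⁻ w₁ w₂ v∈ = ∈-++⁻ (initVerts w₁) (subst (_ ∈_) (verts-◅◅ w₁ w₂) v∈)

  verts-◅◅⁺ˡ : (w₁ : Walk E a b) (w₂ : Walk E b c) → verts w₁ ⊆ verts (w₁ ◅◅ w₂)
  verts-◅◅⁺ˡ w₁ w₂ v∈ with ∈-verts⁻ʳ w₁ v∈
  ... | inj₁ v∈init = subst (_ ∈_) (sym (verts-◅◅ w₁ w₂)) (∈-++⁺ˡ v∈init)
  ... | inj₂ refl   = subst (_ ∈_) (sym (verts-◅◅ w₁ w₂)) (∈-++⁺ʳ (initVerts w₁) (first∈verts w₂))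

  verts-◅◅⁺ʳ : (w₁ : Walk E a b) (w₂ : Walk E b c) → verts w₂ ⊆ verts (w₁ ◅◅ w₂)
  verts-◅◅⁺ʳ w₁ w₂ v∈ = subst (_ ∈_) (sym (verts-◅◅ w₁ w₂)) (∈-++⁺ʳ (initVerts w₁) v∈)

  initVerts-◅◅⁺ˡ : (w₁ : Walk E a b) (w₂ : Walk E b c) → initVerts w₁ ⊆ initVerts (w₁ ◅◅ w₂)
  initVerts-◅◅⁺ˡ (e ◅ w₁) w₂ (here refl) = here refl
  initVerts-◅◅⁺ˡ (e ◅ w₁) w₂ (there v∈)  = there (initVerts-◅◅⁺ˡ w₁ w₂ v∈)

  tailVerts-◅◅⁺ʳ : (w₁ : Walk E a b) (w₂ : Walk E b c) → tailVerts w₂ ⊆ tailVerts (w₁ ◅◅ w₂)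
  tailVerts-◅◅⁺ʳ (stop _) w₂ v∈ = v∈
  tailVerts-◅◅⁺ʳ (e ◅ w₁) w₂ v∈ = verts-◅◅⁺ʳ w₁ w₂ (tailVerts⊆verts w₂ v∈)

  record Cut (w : Walk E a c) (b : V) : Set where
    constructor cut
    field
      front : Walk E a b
      back  : Walk E b c
      glue  : front ◅◅ back ≡ w

    front⊆ : verts front ⊆ verts w
    front⊆ v∈ = subst (λ w′ → _ ∈ verts w′) glue (verts-◅◅⁺ˡ front back v∈)

    back⊆ : verts back ⊆ verts w
    back⊆ v∈ = subst (λ w′ → _ ∈ verts w′) glue (verts-◅◅⁺ʳ front back v∈)

    initFront⊆ : initVerts front ⊆ initVerts w
    initFront⊆ v∈ = subst (λ w′ → _ ∈ initVerts w′) glue (initVerts-◅◅⁺ˡ front back v∈)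

    tailBack⊆ : tailVerts back ⊆ tailVerts w
    tailBack⊆ v∈ = subst (λ w′ → _ ∈ tailVerts w′) glue (tailVerts-◅◅⁺ʳ front back v∈)

    private
      split-verts : Unique (verts w) → Unique (initVerts front ++ verts back)
      split-verts uniq = subst Unique (verts-◅◅ front back) (subst (Unique ∘ verts) (sym glue) uniq)

    front-unique : Unique (verts w) → Unique (verts front)
    front-unique uniq = subst Unique (sym (verts≡initVerts∷ʳ front))
      (Unique-∷ʳ (initVerts front) (split-verts uniq) (first∈verts back))

    back-unique : Unique (verts w) → Unique (verts back)
    back-unique uniq = Unique-++⁻ʳ (initVerts front) (split-verts uniq)

  open Cut using (front; back)

  _◅ᶜ_ : ∀ {w : Walk E b c} (e : (a , b) ∈ E) → Cut w t → Cut (e ◅ w) t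
  e ◅ᶜ cut front back glue = cut (e ◅ front) back (cong (e ◅_) glue)

  cutAt : (w : Walk E a c) → b ∈ verts w → Cut w b
  cutAt (stop a)      (here refl) = cut (stop a) (stop a) refl
  cutAt (_◅_ {a} e w) (here refl) = cut (stop a) (e ◅ w) refl
  cutAt (e ◅ w)       (there b∈)  = e ◅ᶜ cutAt w b∈

  record FirstHit (X : Pred V 0ℓ) (w : Walk E a c) : Set where
    constructor firstHit
    field
      {hit}   : V
      hit∈X   : X hit
      cutHit  : Cut w hit
      before  : All (∁ X) (initVerts (front cutHit))

  record LastHit (X : Pred V 0ℓ) (w : Walk E a c) : Set where
    constructor lastHit
    field
      {hit}   : V
      hit∈X   : X hit
      cutHit  : Cut w hit
      after   : All (∁ X) (tailVerts (back cutHit))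

  first-hit : Decidable X → (w : Walk E a c) → Any X (verts w) → FirstHit X w
  first-hit X? (stop a) (here Xa) = firstHit Xa (cut (stop a) (stop a) refl) []
  first-hit X? (_◅_ {a} e w) hits with X? a
  ... | yes Xa = firstHit Xa (cut (stop a) (e ◅ w) refl) []
  ... | no ¬Xa with firstHit Xh κ clear ← first-hit X? w (Any.tail ¬Xa hits) =
    firstHit Xh (e ◅ᶜ κ) (¬Xa ∷ clear)

  last-hit : Decidable X → (w : Walk E a c) → Any X (verts w) → LastHit X w
  last-hit X? (stop a) (here Xa) = lastHit Xa (cut (stop a) (stop a) refl) []
  last-hit X? (_◅_ {a} e w) hits with Any.any? X? (verts w)
  ... | yes later with lastHit Xh κ clear ← last-hit X? w later = lastHit Xh (e ◅ᶜ κ) clear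
  ... | no ¬later = lastHit (Any.head ¬later hits) (cut (stop a) (e ◅ w) refl) (All.¬Any⇒All¬ (verts w) ¬later)

  weaken : ∀ {e} → Walk E a b → Walk (e ∷ E) a b
  weaken (stop a) = stop a
  weaken (e ◅ w)  = there e ◅ weaken w

  verts-weaken : ∀ {e} (w : Walk E a b) → verts (weaken {e = e} w) ≡ verts w
  verts-weaken (stop a) = refl
  verts-weaken (e ◅ w)  = cong (_ ∷_) (verts-weaken w)

  initVerts-weaken : ∀ {e} (w : Walk E a b) → initVerts (weaken {e = e} w) ≡ initVerts w
  initVerts-weaken (stop a) = refl
  initVerts-weaken (e ◅ w)  = cong (_ ∷_) (initVerts-weaken w)

  unextend : (w : Walk ((x , y) ∷ E) a b) →
             (x ∈ initVerts w × y ∈ tailVerts w) ⊎ (Σ[ w′ ∈ Walk E a b ] verts w′ ≡ verts w)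
  unextend (stop a) = inj₂ (stop a , refl)
  unextend (here refl ◅ w) = inj₁ (here refl , first∈verts w)
  unextend (there e ◅ w) with unextend w
  ... | inj₁ (x∈ , y∈) = inj₁ (there x∈ , tailVerts⊆verts w y∈)
  ... | inj₂ (w′ , eq) = inj₂ (e ◅ w′ , cong (_ ∷_) eq)

  -- Linkages and separators

  record Path (E : Edges) (A B : Pred V 0ℓ) : Set where
    constructor mkPath
    field
      {src tgt} : V
      src∈A     : A src
      tgt∈B     : B tgt
      walk      : Walk E src tgt

    vertices : List V
    vertices = verts walk

  record Linkage (E : Edges) (A B : Pred V 0ℓ) (k : ℕ) : Set where
    constructor linkage
    field
      path     : Fin k → Path E A B
      simple   : ∀ i → Unique (Path.vertices (path i))
      disjoint : ∀ {i j} → i ≢ j → Disjoint (Path.vertices (path i)) (Path.vertices (path j))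

    vertices : Fin k → List V
    vertices i = Path.vertices (path i)

    meet⇒≡ : ∀ {i j} → v ∈ vertices i → v ∈ vertices j → i ≡ j
    meet⇒≡ {i = i} {j} v∈i v∈j with i ≟ᶠ j
    ... | yes i≡j = i≡j
    ... | no i≢j  = contradiction (v∈i , v∈j) (disjoint i≢j)

    src-injective : Injective _≡_ _≡_ (Path.src ∘ path)
    src-injective {i} {j} eq =
      meet⇒≡ (first∈verts (Path.walk (path i))) (subst (_∈ vertices j) (sym eq) (first∈verts (Path.walk (path j))))

    tgt-injective : Injective _≡_ _≡_ (Path.tgt ∘ path)
    tgt-injective {i} {j} eq =
      meet⇒≡ (last∈verts (Path.walk (path i))) (subst (_∈ vertices j) (sym eq) (last∈verts (Path.walk (path j))))

  open Path using (src; tgt; src∈A; tgt∈B; walk)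

  private variable
    E′ : Edges
    A′ B′ : Pred V 0ℓ

  sublinkage : (L : Linkage E A B k) (P : Fin k → Path E′ A′ B′) → (∀ i → Unique (Path.vertices (P i))) →
               (∀ i → Path.vertices (P i) ⊆ Linkage.vertices L i) → Linkage E′ A′ B′ k
  sublinkage L P simple P⊆L = linkage P simple λ i≢j (v∈i , v∈j) → Linkage.disjoint L i≢j (P⊆L _ v∈i , P⊆L _ v∈j)

  retarget : B ⇒ B′ → Linkage E A B k → Linkage E A B′ k
  retarget B⇒B′ L = sublinkage L retargeted (Linkage.simple L) (λ _ v∈ → v∈)
    where
    retargeted : _ → Path _ _ _
    retargeted i = let mkPath a∈A b∈B w = Linkage.path L i in mkPath a∈A (B⇒B′ b∈B) w

  weakenLinkage : ∀ {e} → Linkage E A B k → Linkage (e ∷ E) A B k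
  weakenLinkage L = sublinkage L weakened
    (λ i → subst Unique (sym (verts-weaken (walk (Linkage.path L i)))) (Linkage.simple L i))
    (λ i → subst (_ ∈_) (verts-weaken (walk (Linkage.path L i))))
    where
    weakened : _ → Path _ _ _
    weakened i = let mkPath a∈A b∈B w = Linkage.path L i in mkPath a∈A b∈B (weaken w)

  shrinkLinkage : ∀ {j} → j ≤ k → Linkage E A B k → Linkage E A B j
  shrinkLinkage j≤k L = linkage (path ∘ embed) (simple ∘ embed)
    (λ i≢j → disjoint (i≢j ∘ inject≤-injective j≤k j≤k _ _))
    where
    open Linkage L
    embed : Fin _ → Fin _
    embed i = inject≤ i j≤k

  emptyLinkage : Linkage E A B 0
  emptyLinkage = linkage (λ ()) (λ ()) (λ {i} → contradiction i ¬Fin0)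

  trivialLinkage : Unique Z → All (A ∩ B) Z → Linkage E A B (length Z)
  trivialLinkage {Z = Z} uniq A∩B = linkage trivial (λ _ → [] ∷ []) disjoint
    where
    trivial : Fin (length Z) → Path _ _ _
    trivial i = let a∈A , a∈B = All.lookup A∩B (∈-lookup i) in mkPath a∈A a∈B (stop (lookup Z i))
    disjoint : ∀ {i j} → i ≢ j → Disjoint (Path.vertices (trivial i)) (Path.vertices (trivial j))
    disjoint i≢j (here refl , here eq) = i≢j (lookup-injective uniq _ _ eq)

  Separates : Edges → Pred V 0ℓ → Pred V 0ℓ → List V → Set
  Separates E A B Z = ∀ {a b} → A a → B b → (w : Walk E a b) → ∃[ z ] z ∈ verts w × z ∈ Z

  LinkagesAtMost : Edges → Pred V 0ℓ → Pred V 0ℓ → ℕ → Set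
  LinkagesAtMost E A B k = ∀ {j} → Linkage E A B j → j ≤ k

  SeparatorsAtLeast : Edges → Pred V 0ℓ → Pred V 0ℓ → ℕ → Set
  SeparatorsAtLeast E A B k = ∀ Z → Separates E A B Z → k ≤ length Z

  linkage≤separator : Linkage E A B k → Separates E A B Z → k ≤ length Z
  linkage≤separator {Z = Z} L sep = injective⇒≤ (λ {i} {j} → crossing-inj {i} {j})
    where
    open Linkage L
    crossing : ∀ i → ∃[ z ] z ∈ vertices i × z ∈ Z
    crossing i = let mkPath a∈A b∈B w = path i in sep a∈A b∈B w
    crossing-inj : Injective _≡_ _≡_ (index ∘ proj₂ ∘ proj₂ ∘ crossing)
    crossing-inj {i} {j} eq with z , z∈i , z∈Z ← crossing i | z′ , z′∈j , z′∈Z ← crossing j =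
      meet⇒≡ z∈i (subst (_∈ vertices j) (index-injective z′∈Z z∈Z (sym eq)) z′∈j)

  Linkage-fromList : (Ps : List (Path E A B)) → Unique (concatMap Path.vertices Ps) → Linkage E A B (length Ps)
  Linkage-fromList Ps uniq =
    linkage (lookup Ps) (concatMap-unique⁻ Path.vertices Ps uniq) (concatMap-disjoint⁻ Path.vertices Ps uniq)

  Linkage-toList : Linkage E A B k → ∃[ Ps ] Unique (concatMap Path.vertices Ps) × length Ps ≡ k
  Linkage-toList L =
    tabulate path ,
    subst Unique (cong concat (sym (map-tabulate path Path.vertices)))
      (Unique.concat⁺ (All.tabulate⁺ simple) (AllPairs.tabulate⁺ disjoint)) ,
    length-tabulate path
    where open Linkage L

  -- Uncrossing separators

  data ReachAvoiding (E : Edges) (A : Pred V 0ℓ) (Z : List V) : Pred V 0ℓ where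
    start : A a → a ∉ Z → ReachAvoiding E A Z a
    step  : ReachAvoiding E A Z a → (a , b) ∈ E → b ∉ Z → ReachAvoiding E A Z b

  reach-∉ : ReachAvoiding E A Z a → a ∉ Z
  reach-∉ (start _ a∉Z)  = a∉Z
  reach-∉ (step _ _ a∉Z) = a∉Z

  reach-start : A a → a ∈ Z ⊎ ReachAvoiding E A Z a
  reach-start {a = a} {Z = Z} a∈A with a ∈? Z
  ... | yes a∈Z = inj₁ a∈Z
  ... | no a∉Z  = inj₂ (start a∈A a∉Z)

  reach-step : ReachAvoiding E A Z a → (a , b) ∈ E → b ∈ Z ⊎ ReachAvoiding E A Z b
  reach-step {Z = Z} {b = b} r e with b ∈? Z
  ... | yes b∈Z = inj₁ b∈Z
  ... | no b∉Z  = inj₂ (step r e b∉Z)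

  reach-separated : Separates E A X Z → ReachAvoiding E A Z a → (w : Walk E a b) → X b →
                    ∃[ z ] z ∈ verts w × z ∈ Z
  reach-separated sep (start a∈A _) w b∈X = sep a∈A b∈X w
  reach-separated sep (step r e _)  w b∈X with reach-separated sep r (e ◅ w) b∈X
  ... | z , here refl , z∈Z = contradiction z∈Z (reach-∉ r)
  ... | z , there z∈w , z∈Z = z , z∈w , z∈Z

  reach-blocked : Separates E A X Z → ReachAvoiding E A Z a → ¬ X a
  reach-blocked sep r a∈X with reach-separated sep r (stop _) a∈X
  ... | z , here refl , z∈Z = reach-∉ r z∈Z

  module Uncross {E : Edges} {A X₁ X₂ : Pred V 0ℓ} {Z₁ Z₂ : List V}
                 (sep₁ : Separates E A X₁ Z₁) (sep₂ : Separates E A X₂ Z₂)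
                 (R₁? : Decidable (ReachAvoiding E A Z₁)) (R₂? : Decidable (ReachAvoiding E A Z₂)) where

    R₁ R₂ : Pred V 0ℓ
    R₁ = ReachAvoiding E A Z₁
    R₂ = ReachAvoiding E A Z₂

    -- Φ holds at the vertices that, seen from A, are not beyond either separator; Ψ keeps a
    -- vertex of Z₁ ∩ Z₂ from being counted twice in D∪.
    Φ Ψ : Pred V 0ℓ
    Φ v = (v ∈ Z₁ ⊎ R₁ v) × (v ∈ Z₂ ⊎ R₂ v)
    Ψ v = Φ v × v ∉ Z₁

    Φ? : Decidable Φ
    Φ? v = ((v ∈? Z₁) ⊎-dec R₁? v) ×-dec ((v ∈? Z₂) ⊎-dec R₂? v)

    Ψ? : Decidable Ψ
    Ψ? v = Φ? v ×-dec ¬? (v ∈? Z₁)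

    D∪ D∩ : List V
    D∪ = filter Φ? Z₁ ++ filter Ψ? Z₂
    D∩ = filter (∁? Φ?) Z₁ ++ filter (∁? Ψ?) Z₂

    length-D : length D∪ + length D∩ ≡ length Z₁ + length Z₂
    length-D = begin
      length D∪ + length D∩   ≡⟨ cong₂ _+_ (length-++ (filter Φ? Z₁)) (length-++ (filter (∁? Φ?) Z₁)) ⟩
      (φ₁ + ψ₂) + (φ₁ᶜ + ψ₂ᶜ) ≡⟨ interchange +-commutativeSemigroup φ₁ ψ₂ φ₁ᶜ ψ₂ᶜ ⟩
      (φ₁ + φ₁ᶜ) + (ψ₂ + ψ₂ᶜ) ≡⟨ cong₂ _+_ (length-filter-∁ Φ? Z₁) (length-filter-∁ Ψ? Z₂) ⟩
      length Z₁ + length Z₂   ∎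
      where
      open ≡-Reasoning
      φ₁ φ₁ᶜ ψ₂ ψ₂ᶜ : ℕ
      φ₁  = length (filter Φ? Z₁)
      φ₁ᶜ = length (filter (∁? Φ?) Z₁)
      ψ₂  = length (filter Ψ? Z₂)
      ψ₂ᶜ = length (filter (∁? Ψ?) Z₂)

    classify∪ : Φ v → (R₁ v × R₂ v) ⊎ v ∈ D∪
    classify∪ {v} φ with v ∈? Z₁ | v ∈? Z₂ | φ
    ... | yes v∈Z₁ | _        | _ = inj₂ (∈-++⁺ˡ (∈-filter⁺ Φ? v∈Z₁ φ))
    ... | no v∉Z₁  | yes v∈Z₂ | _ = inj₂ (∈-++⁺ʳ _ (∈-filter⁺ Ψ? v∈Z₂ (φ , v∉Z₁)))
    ... | no v∉Z₁  | no _     | inj₁ v∈Z₁ , _ = contradiction v∈Z₁ v∉Z₁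
    ... | no _     | no v∉Z₂  | _ , inj₁ v∈Z₂ = contradiction v∈Z₂ v∉Z₂
    ... | no _     | no _     | inj₂ r₁ , inj₂ r₂ = inj₁ (r₁ , r₂)

    classify∩ : (v ∈ Z₁ ⊎ R₁ v) ⊎ (v ∈ Z₂ ⊎ R₂ v) → (R₁ v ⊎ R₂ v) ⊎ v ∈ D∩
    classify∩ {v} entered with R₁? v | R₂? v | v ∈? Z₁ | v ∈? Z₂
    ... | yes r₁ | _      | _        | _        = inj₁ (inj₁ r₁)
    ... | no _   | yes r₂ | _        | _        = inj₁ (inj₂ r₂)
    ... | no _   | no _   | yes v∈Z₁ | yes v∈Z₂ = inj₂ (∈-++⁺ʳ _ (∈-filter⁺ (∁? Ψ?) v∈Z₂ (λ ψ → proj₂ ψ v∈Z₁)))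
    ... | no _   | no ¬r₂ | yes v∈Z₁ | no v∉Z₂  =
      inj₂ (∈-++⁺ˡ (∈-filter⁺ (∁? Φ?) v∈Z₁ (λ φ → [ v∉Z₂ , ¬r₂ ] (proj₂ φ))))
    ... | no ¬r₁ | no _   | no v∉Z₁  | yes v∈Z₂ =
      inj₂ (∈-++⁺ʳ _ (∈-filter⁺ (∁? Ψ?) v∈Z₂ (λ ψ → [ v∉Z₁ , ¬r₁ ] (proj₁ (proj₁ ψ)))))
    ... | no ¬r₁ | no ¬r₂ | no v∉Z₁  | no v∉Z₂  = ⊥-elim ([ [ v∉Z₁ , ¬r₁ ] , [ v∉Z₂ , ¬r₂ ] ] entered)

    ∪-hit : (w : Walk E a b) → R₁ a × R₂ a → (X₁ ∪ X₂) b → ∃[ z ] z ∈ verts w × z ∈ D∪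
    ∪-hit (stop a) (r₁ , _) (inj₁ b∈X₁) = ⊥-elim (reach-blocked sep₁ r₁ b∈X₁)
    ∪-hit (stop a) (_ , r₂) (inj₂ b∈X₂) = ⊥-elim (reach-blocked sep₂ r₂ b∈X₂)
    ∪-hit (e ◅ w) (r₁ , r₂) b∈X with classify∪ (reach-step r₁ e , reach-step r₂ e)
    ... | inj₁ r   = let z , z∈ , z∈D = ∪-hit w r b∈X in z , there z∈ , z∈D
    ... | inj₂ v∈D = _ , there (first∈verts w) , v∈D

    ∩-hit : (w : Walk E a b) → R₁ a ⊎ R₂ a → (X₁ ∩ X₂) b → ∃[ z ] z ∈ verts w × z ∈ D∩
    ∩-hit (stop a) (inj₁ r₁) (b∈X₁ , _) = ⊥-elim (reach-blocked sep₁ r₁ b∈X₁)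
    ∩-hit (stop a) (inj₂ r₂) (_ , b∈X₂) = ⊥-elim (reach-blocked sep₂ r₂ b∈X₂)
    ∩-hit (e ◅ w) r b∈X with classify∩ (Sum.map (λ r₁ → reach-step r₁ e) (λ r₂ → reach-step r₂ e) r)
    ... | inj₁ r′  = let z , z∈ , z∈D = ∩-hit w r′ b∈X in z , there z∈ , z∈D
    ... | inj₂ v∈D = _ , there (first∈verts w) , v∈D

    D∪-separates : Separates E A (X₁ ∪ X₂) D∪
    D∪-separates a∈A b∈X w with classify∪ (reach-start a∈A , reach-start a∈A)
    ... | inj₁ r   = ∪-hit w r b∈X
    ... | inj₂ a∈D = _ , first∈verts w , a∈D

    D∩-separates : Separates E A (X₁ ∩ X₂) D∩
    D∩-separates a∈A b∈X w with classify∩ (inj₁ (reach-start a∈A))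
    ... | inj₁ r   = ∩-hit w r b∈X
    ... | inj₂ a∈D = _ , first∈verts w , a∈D

  -- Menger's theorem

  separates-∷⁻ : v ∈ Z → Separates E A B (v ∷ Z) → Separates E A B Z
  separates-∷⁻ v∈Z sep a∈A b∈B w with sep a∈A b∈B w
  ... | z , z∈w , here refl  = z , z∈w , v∈Z
  ... | z , z∈w , there z∈Z = z , z∈w , z∈Z

  module _ (sep : Separates E A B Z) {a b} (a∈A : A a) (b∈B : B b) (w : Walk ((x , y) ∷ E) a b) where

    separates-unextend : (x ∈ verts w × y ∈ verts w) ⊎ ∃[ z ] z ∈ verts w × z ∈ Z
    separates-unextend with unextend w
    ... | inj₁ (x∈ , y∈) = inj₁ (initVerts⊆verts w x∈ , tailVerts⊆verts w y∈)
    ... | inj₂ (w′ , eq) = let z , z∈ , z∈Z = sep a∈A b∈B w′ in inj₂ (z , subst (z ∈_) eq z∈ , z∈Z)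

  separates-extendˡ : Separates E A B Z → Separates ((x , y) ∷ E) A B (x ∷ Z)
  separates-extendˡ sep a∈A b∈B w with separates-unextend sep a∈A b∈B w
  ... | inj₁ (x∈ , _)       = _ , x∈ , here refl
  ... | inj₂ (z , z∈ , z∈Z) = z , z∈ , there z∈Z

  separates-extendʳ : Separates E A B Z → Separates ((x , y) ∷ E) A B (y ∷ Z)
  separates-extendʳ sep a∈A b∈B w with separates-unextend sep a∈A b∈B w
  ... | inj₁ (_ , y∈)       = _ , y∈ , here refl
  ... | inj₂ (z , z∈ , z∈Z) = z , z∈ , there z∈Z

  module _ {W : List V} (sep : Separates ((x , y) ∷ E) A B W) where

    separates-viaˡ : x ∈ W → Separates E A (_∈ W) Z → Separates ((x , y) ∷ E) A B Z
    separates-viaˡ x∈W sepZ a∈A b∈B w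
      with z , z∈w , z∈W ← sep a∈A b∈B w
      with firstHit h∈W κ clear ← first-hit (_∈? W) w (lose z∈w z∈W)
      with unextend (front κ)
    ... | inj₁ (x∈init , _) = contradiction x∈W (All.lookup clear x∈init)
    ... | inj₂ (w′ , eq) = let u , u∈ , u∈Z = sepZ a∈A h∈W w′ in u , Cut.front⊆ κ (subst (u ∈_) eq u∈) , u∈Z

    separates-viaʳ : y ∈ W → Separates E (_∈ W) B Z → Separates ((x , y) ∷ E) A B Z
    separates-viaʳ y∈W sepZ a∈A b∈B w
      with z , z∈w , z∈W ← sep a∈A b∈B w
      with lastHit h∈W κ clear ← last-hit (_∈? W) w (lose z∈w z∈W)
      with unextend (back κ)
    ... | inj₁ (_ , y∈tail) = contradiction y∈W (All.lookup clear y∈tail)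
    ... | inj₂ (w′ , eq) = let u , u∈ , u∈Z = sepZ h∈W b∈B w′ in u , Cut.back⊆ κ (subst (u ∈_) eq u∈) , u∈Z

  Gluable : V → V → V → V → Set
  Gluable x y t s = (t ≡ x × s ≡ y) ⊎ t ≡ s

  glue : (p : Walk E a t) (q : Walk E s b) → Gluable x y t s → Walk ((x , y) ∷ E) a b
  glue p q (inj₁ (refl , refl)) = weaken p ◅◅ (here refl ◅ weaken q)
  glue p q (inj₂ refl)          = weaken p ◅◅ weaken q

  module _ (p : Walk E a t) (q : Walk E s b) where

    verts-glue-edge : (m : t ≡ x × s ≡ y) → verts (glue p q (inj₁ m)) ≡ verts p ++ verts q
    verts-glue-edge (refl , refl) = begin
      verts (weaken p ◅◅ (here refl ◅ weaken q)) ≡⟨ verts-◅◅ (weaken p) _ ⟩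
      initVerts (weaken p) ++ t ∷ verts (weaken q) ≡⟨ cong₂ (λ is vs → is ++ t ∷ vs) (initVerts-weaken p) (verts-weaken q) ⟩
      initVerts p ++ t ∷ verts q                   ≡⟨ ++-assoc (initVerts p) (t ∷ []) (verts q) ⟨
      (initVerts p ∷ʳ t) ++ verts q                ≡⟨ cong (_++ verts q) (verts≡initVerts∷ʳ p) ⟨
      verts p ++ verts q                           ∎
      where open ≡-Reasoning

    verts-glue-vertex : (m : t ≡ s) → verts (glue {x = x} {y = y} p q (inj₂ m)) ≡ initVerts p ++ verts q
    verts-glue-vertex refl = trans (verts-◅◅ (weaken p) (weaken q)) (cong₂ _++_ (initVerts-weaken p) (verts-weaken q))

    glue⊆ : (m : Gluable x y t s) → v ∈ verts (glue p q m) → v ∈ verts p ⊎ v ∈ verts q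
    glue⊆ (inj₁ m) v∈ = ∈-++⁻ (verts p) (subst (_ ∈_) (verts-glue-edge m) v∈)
    glue⊆ (inj₂ m) v∈ with ∈-++⁻ (initVerts p) (subst (_ ∈_) (verts-glue-vertex m) v∈)
    ... | inj₁ v∈init = inj₁ (initVerts⊆verts p v∈init)
    ... | inj₂ v∈q    = inj₂ v∈q

    glue-unique : (m : Gluable x y t s) → x ∉ Z → Unique (verts p) → Unique (verts q) →
                  All (_∉ Z) (initVerts p) → (∀ {v} → v ∈ verts p → v ∈ verts q → v ∈ Z) →
                  Unique (verts (glue p q m))
    glue-unique (inj₁ m@(refl , _)) x∉Z uniq-p uniq-q p-clear meet =
      subst Unique (sym (verts-glue-edge m)) (Unique.++⁺ uniq-p uniq-q disjoint)
      where
      disjoint : Disjoint (verts p) (verts q)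
      disjoint (v∈p , v∈q) with ∈-verts⁻ʳ p v∈p
      ... | inj₁ v∈init = All.lookup p-clear v∈init (meet v∈p v∈q)
      ... | inj₂ refl   = x∉Z (meet v∈p v∈q)
    glue-unique (inj₂ m) x∉Z uniq-p uniq-q p-clear meet =
      subst Unique (sym (verts-glue-vertex m)) (Unique.++⁺ uniq-init uniq-q disjoint)
      where
      uniq-init : Unique (initVerts p)
      uniq-init = Unique-++⁻ˡ (initVerts p) (subst Unique (verts≡initVerts∷ʳ p) uniq-p)
      disjoint : Disjoint (initVerts p) (verts q)
      disjoint (v∈init , v∈q) = All.lookup p-clear v∈init (meet (initVerts⊆verts p v∈init) v∈q)

  firstHits : Decidable X → Linkage E A X k →
              Σ[ L ∈ Linkage E A X k ] ∀ i → All (∁ X) (initVerts (walk (Linkage.path L i)))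
  firstHits X? L =
    sublinkage L shortened (λ i → Cut.front-unique (cutHit i) (simple i)) (λ i → Cut.front⊆ (cutHit i)) ,
    FirstHit.before ∘ hit
    where
    open Linkage L
    hit : ∀ i → FirstHit _ (walk (path i))
    hit i = first-hit X? _ (lose (last∈verts _) (tgt∈B (path i)))
    cutHit = FirstHit.cutHit ∘ hit
    shortened : Fin _ → Path _ _ _
    shortened i = mkPath (src∈A (path i)) (FirstHit.hit∈X (hit i)) (front (cutHit i))

  lastHits : Decidable X → Linkage E X B k →
             Σ[ L ∈ Linkage E X B k ] ∀ i → All (∁ X) (tailVerts (walk (Linkage.path L i)))
  lastHits X? L =
    sublinkage L shortened (λ i → Cut.back-unique (cutHit i) (simple i)) (λ i → Cut.back⊆ (cutHit i)) ,
    LastHit.after ∘ hit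
    where
    open Linkage L
    hit : ∀ i → LastHit _ (walk (path i))
    hit i = last-hit X? _ (lose (first∈verts _) (src∈A (path i)))
    cutHit = LastHit.cutHit ∘ hit
    shortened : Fin _ → Path _ _ _
    shortened i = mkPath (LastHit.hit∈X (hit i)) (tgt∈B (path i)) (back (cutHit i))

  module Join {A B : Pred V 0ℓ} {E : Edges} {x y : V} {Z : List V} {k : ℕ}
              (sepZ : Separates E A B Z) (x∉Z : x ∉ Z) (y∉Z : y ∉ Z) (k≡ : k ≡ suc (length Z))
              (P : Linkage E A (_∈ x ∷ Z) k) (P-clear : ∀ i → All (_∉ x ∷ Z) (initVerts (walk (Linkage.path P i))))
              (Q : Linkage E (_∈ y ∷ Z) B k) (Q-clear : ∀ j → All (_∉ y ∷ Z) (tailVerts (walk (Linkage.path Q j))))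
              where

    private
      module P = Linkage P
      module Q = Linkage Q

    exit entry : Fin k → V
    exit i  = tgt (P.path i)
    entry j = src (Q.path j)

    p : ∀ i → Walk E (src (P.path i)) (exit i)
    p i = walk (P.path i)

    q : ∀ j → Walk E (entry j) (tgt (Q.path j))
    q j = walk (Q.path j)

    meet⇒∈Z : ∀ i j {v} → v ∈ verts (p i) → v ∈ verts (q j) → v ∈ Z
    -- A common vertex off Z would give a walk from A to B in E avoiding Z.
    meet⇒∈Z i j {v} v∈p v∈q with v ∈? Z
    ... | yes v∈Z = v∈Z
    ... | no v∉Z = contradiction (sepZ (src∈A (P.path i)) (tgt∈B (Q.path j)) (front κ ◅◅ back κ′)) no-crossing
      where
      κ  = cutAt (p i) v∈p
      κ′ = cutAt (q j) v∈q
      no-crossing : ¬ (∃[ z ] z ∈ verts (front κ ◅◅ back κ′) × z ∈ Z)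
      no-crossing (z , z∈ , z∈Z) with ∈-◅◅⁻ (front κ) (back κ′) z∈
      ... | inj₁ z∈init = All.lookup (P-clear i) (Cut.initFront⊆ κ z∈init) (there z∈Z)
      ... | inj₂ z∈back with ∈-verts⁻ˡ (back κ′) z∈back
      ...   | inj₁ refl   = v∉Z z∈Z
      ...   | inj₂ z∈tail = All.lookup (Q-clear j) (Cut.tailBack⊆ κ′ z∈tail) (there z∈Z)

    exit-on-Z : ∀ i → v ∈ verts (p i) → v ∈ Z → v ≡ exit i
    exit-on-Z i v∈p v∈Z with ∈-verts⁻ʳ (p i) v∈p
    ... | inj₁ v∈init = contradiction (there v∈Z) (All.lookup (P-clear i) v∈init)
    ... | inj₂ v≡exit = v≡exit

    entry-on-Z : ∀ j → v ∈ verts (q j) → v ∈ Z → v ≡ entry j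
    entry-on-Z j v∈q v∈Z with ∈-verts⁻ˡ (q j) v∈q
    ... | inj₁ v≡entry = v≡entry
    ... | inj₂ v∈tail  = contradiction (there v∈Z) (All.lookup (Q-clear j) v∈tail)

    partner : v ∈ x ∷ Z → V
    partner (here _)      = y
    partner {v} (there _) = v

    partner∈ : (v∈ : v ∈ x ∷ Z) → partner v∈ ∈ y ∷ Z
    partner∈ (here _)    = here refl
    partner∈ (there v∈Z) = there v∈Z

    gluable-partner : (v∈ : v ∈ x ∷ Z) → Gluable x y v (partner v∈)
    gluable-partner (here v≡x) = inj₁ (v≡x , refl)
    gluable-partner (there _)  = inj₂ refl

    partner-injective : (v∈ : v ∈ x ∷ Z) (v′∈ : v′ ∈ x ∷ Z) → partner v∈ ≡ partner v′∈ → v ≡ v′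
    partner-injective (here v≡x)  (here v′≡x)  _    = trans v≡x (sym v′≡x)
    partner-injective (here _)    (there v′∈Z) refl = contradiction v′∈Z y∉Z
    partner-injective (there v∈Z) (here _)     refl = contradiction v∈Z y∉Z
    partner-injective (there _)   (there _)    eq   = eq

    exit∈ : ∀ i → exit i ∈ x ∷ Z
    exit∈ i = tgt∈B (P.path i)

    -- The k entries are distinct and y ∷ Z has k elements, so every vertex of y ∷ Z is an entry.
    τ-spec : ∀ i → ∃[ j ] entry j ≡ partner (exit∈ i)
    τ-spec i = injective⇒onto (y ∷ Z) (sym k≡) entry (src∈A ∘ Q.path) Q.src-injective (partner∈ (exit∈ i))

    τ : Fin k → Fin k
    τ = proj₁ ∘ τ-spec

    gluable : ∀ i → Gluable x y (exit i) (entry (τ i))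
    gluable i = subst (Gluable x y (exit i)) (sym (proj₂ (τ-spec i))) (gluable-partner (exit∈ i))

    τ-injective : Injective _≡_ _≡_ τ
    τ-injective {i} {i′} eq = P.tgt-injective (partner-injective (exit∈ i) (exit∈ i′)
      (trans (sym (proj₂ (τ-spec i))) (trans (cong entry eq) (proj₂ (τ-spec i′)))))

    crossing : ∀ i j → v ∈ verts (p i) → v ∈ verts (q j) → τ i ≡ j
    crossing i j v∈p v∈q with meet⇒∈Z i j v∈p v∈q | gluable i
    ... | v∈Z | inj₁ (exit≡x , _) = contradiction (subst (_∈ Z) (trans (exit-on-Z i v∈p v∈Z) exit≡x) v∈Z) x∉Z
    ... | v∈Z | inj₂ exit≡entry   =
      Q.src-injective (trans (sym exit≡entry) (trans (sym (exit-on-Z i v∈p v∈Z)) (entry-on-Z j v∈q v∈Z)))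

    joined-path : Fin k → Path ((x , y) ∷ E) A B
    joined-path i = mkPath (src∈A (P.path i)) (tgt∈B (Q.path (τ i))) (glue (p i) (q (τ i)) (gluable i))

    joined-simple : ∀ i → Unique (Path.vertices (joined-path i))
    joined-simple i = glue-unique (p i) (q (τ i)) (gluable i) x∉Z (P.simple i) (Q.simple (τ i))
      (All.map (_∘ there) (P-clear i)) (meet⇒∈Z i (τ i))

    joined-disjoint : ∀ {i i′} → i ≢ i′ → Disjoint (Path.vertices (joined-path i)) (Path.vertices (joined-path i′))
    joined-disjoint {i} {i′} i≢i′ (v∈i , v∈i′)
      with glue⊆ (p i) (q (τ i)) (gluable i) v∈i | glue⊆ (p i′) (q (τ i′)) (gluable i′) v∈i′
    ... | inj₁ v∈p | inj₁ v∈p′ = i≢i′ (P.meet⇒≡ v∈p v∈p′)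
    ... | inj₂ v∈q | inj₂ v∈q′ = i≢i′ (τ-injective (Q.meet⇒≡ v∈q v∈q′))
    ... | inj₁ v∈p | inj₂ v∈q′ = i≢i′ (τ-injective (crossing i (τ i′) v∈p v∈q′))
    ... | inj₂ v∈q | inj₁ v∈p′ = i≢i′ (sym (τ-injective (crossing i′ (τ i) v∈p′ v∈q)))

    joined : Linkage ((x , y) ∷ E) A B k
    joined = linkage joined-path joined-simple joined-disjoint

  module Finite (allVertices : List V) (complete : ∀ v → v ∈ allVertices) (allVertices-unique : Unique allVertices) where

    ¬¬-decidable : (P : Pred V 0ℓ) → ¬ ¬ Decidable P
    ¬¬-decidable P = (λ P? v → P? (complete v)) <$> decide allVertices
      where
      decide : ∀ xs → ¬ ¬ (∀ {v} → v ∈ xs → Dec (P v))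
      decide []       = pure λ ()
      decide (x ∷ xs) = do
        x?  ← ¬¬-excluded-middle
        xs? ← decide xs
        pure λ { (here refl) → x? ; (there v∈) → xs? v∈ }

    atLeast-or-smaller : ∀ E → ¬ ¬ (SeparatorsAtLeast E A B k ⊎ (∃[ Z ] Separates E A B Z × length Z < k))
    atLeast-or-smaller {k = k} E ¬either =
      ¬either (inj₁ λ Z sep → decidable-stable (k ≤? length Z) λ k≰ → ¬either (inj₂ (Z , sep , ≰⇒> k≰)))

    menger-edgeless : SeparatorsAtLeast [] A B k → ¬ ¬ Linkage [] A B k
    menger-edgeless {A = A} {B = B} large = do
      A∩B? ← ¬¬-decidable (A ∩ B)
      let Z = filter A∩B? allVertices
          sepZ : Separates [] A B Z
          sepZ = λ { a∈A b∈B (stop a) → a , here refl , ∈-filter⁺ A∩B? (complete a) (a∈A , b∈B) }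
      pure (shrinkLinkage (large Z sepZ)
        (trivialLinkage (Unique.filter⁺ A∩B? allVertices-unique) (All.all-filter A∩B? allVertices)))

    menger : ∀ E → SeparatorsAtLeast E A B k → ¬ ¬ Linkage E A B k
    menger-step : ∀ E {x y} → SeparatorsAtLeast ((x , y) ∷ E) A B k →
                  ∀ Z → Separates E A B Z → length Z < k → ¬ ¬ Linkage ((x , y) ∷ E) A B k

    menger []            large = menger-edgeless large
    menger ((x , y) ∷ E) large = atLeast-or-smaller E >>= λ where
      (inj₁ large-in-E)         → weakenLinkage <$> menger E large-in-E
      (inj₂ (Z , sepZ , |Z|<k)) → menger-step E large Z sepZ |Z|<k

    -- Then x ∷ Z and y ∷ Z are minimum separators of
    -- the extended graph, and linkages in E from A onto x ∷ Z and from y ∷ Z to B join along Z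
    -- and the new edge.
    menger-step E {x} {y} large Z sepZ |Z|<k = do
      P ← menger E (λ Y sepY → large Y (separates-viaˡ sepˣ (here refl) sepY))
      Q ← menger E (λ Y sepY → large Y (separates-viaʳ sepʸ (here refl) sepY))
      let P′ , P-clear  = firstHits (_∈? x ∷ Z) P
          Q′ , Q-clear = lastHits (_∈? y ∷ Z) Q
      pure (Join.joined sepZ x∉Z y∉Z k≡ P′ P-clear Q′ Q-clear)
      where
      sepˣ = separates-extendˡ {x = x} {y = y} sepZ
      sepʸ = separates-extendʳ {x = x} {y = y} sepZ
      k≡ = ≤-antisym (large (x ∷ Z) sepˣ) |Z|<k
      x∉Z : x ∉ Z
      x∉Z x∈Z = <⇒≱ |Z|<k (large Z (separates-∷⁻ x∈Z sepˣ))
      y∉Z : y ∉ Z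
      y∉Z y∈Z = <⇒≱ |Z|<k (large Z (separates-∷⁻ y∈Z sepʸ))

    small-separator : LinkagesAtMost E A B k → ¬ ¬ (∃[ Z ] Separates E A B Z × length Z ≤ k)
    small-separator bound ¬small = menger _ all-large (λ L → <-irrefl refl (bound L))
      where
      all-large : SeparatorsAtLeast _ _ _ (suc _)
      all-large Z sep = ≰⇒> λ |Z|≤k → ¬small (Z , sep , |Z|≤k)

    uncross : ∀ {X₁ X₂ Z₁ Z₂} → Separates E A X₁ Z₁ → Separates E A X₂ Z₂ →
              ¬ ¬ (∃₂ λ D∪ D∩ → Separates E A (X₁ ∪ X₂) D∪ × Separates E A (X₁ ∩ X₂) D∩ ×
                               length D∪ + length D∩ ≡ length Z₁ + length Z₂)
    uncross sep₁ sep₂ = do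
      R₁? ← ¬¬-decidable _
      R₂? ← ¬¬-decidable _
      pure (let open Uncross sep₁ sep₂ R₁? R₂? in
        D∪ , D∩ , (λ {_} {_} → D∪-separates) , (λ {_} {_} → D∩-separates) , length-D)

    linkage-submodular : ∀ {X₁ X₂ c₁ c₂ n∪ n∩} → LinkagesAtMost E A X₁ c₁ → LinkagesAtMost E A X₂ c₂ →
                         Linkage E A (X₁ ∪ X₂) n∪ → Linkage E A (X₁ ∩ X₂) n∩ → n∪ + n∩ ≤ c₁ + c₂
    linkage-submodular {c₁ = c₁} {c₂} {n∪} {n∩} bound₁ bound₂ L∪ L∩ = decidable-stable (n∪ + n∩ ≤? c₁ + c₂) do
      Z₁ , sep₁ , |Z₁|≤c₁ ← small-separator bound₁
      Z₂ , sep₂ , |Z₂|≤c₂ ← small-separator bound₂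
      D∪ , D∩ , sep∪ , sep∩ , lengths ← uncross sep₁ sep₂
      pure (begin
        n∪ + n∩               ≤⟨ +-mono-≤ (linkage≤separator L∪ sep∪) (linkage≤separator L∩ sep∩) ⟩
        length D∪ + length D∩ ≡⟨ lengths ⟩
        length Z₁ + length Z₂ ≤⟨ +-mono-≤ |Z₁|≤c₁ |Z₂|≤c₂ ⟩
        c₁ + c₂               ∎)
      where open ≤-Reasoning

    linkage-addTarget : ∀ {c n} → LinkagesAtMost E A B c → Linkage E A (B ∪ ｛ v ｝) n → n ≤ suc c
    linkage-addTarget {c = c} {n} bound L = decidable-stable (n ≤? suc c) do
      Z , sepZ , |Z|≤c ← small-separator bound
      pure (≤-trans (linkage≤separator L (separates-∷ sepZ)) (s≤s |Z|≤c))
      where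
      separates-∷ : ∀ {Z} → Separates _ _ _ Z → Separates _ _ _ (_ ∷ Z)
      separates-∷ sepZ a∈A (inj₁ b∈B) w = let z , z∈ , z∈Z = sepZ a∈A b∈B w in z , z∈ , there z∈Z
      separates-∷ sepZ a∈A (inj₂ refl) w = _ , last∈verts w , here refl

    maximum-linkage : ∀ E A B → ¬ ¬ (∃[ k ] Linkage E A B k × LinkagesAtMost E A B k)
    maximum-linkage E A B = search (length allVertices) (λ L → linkage≤separator L everything)
      where
      everything : Separates E A B allVertices
      everything {a} _ _ w = a , first∈verts w , complete a
      search : ∀ n → LinkagesAtMost E A B n → ¬ ¬ (∃[ k ] Linkage E A B k × LinkagesAtMost E A B k)
      search zero    bound = pure (0 , emptyLinkage , λ {_} → bound)
      search (suc n) bound = ¬¬-excluded-middle >>= λ where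
        (yes L) → pure (suc n , L , λ {_} → bound)
        (no ¬L) → search n (λ L′ → ≤-pred (≤∧≢⇒< (bound L′) λ { refl → ¬L L′ }))

module AlternatingDigraph {np nr : ℕ} (G : Graph np nr) (M : EdgeSet np nr) where

  open import Data.Fin.Subset using (Subset; ⁅_⁆) renaming (_∈_ to _∈ₛ_; _⊆_ to _⊆ₛ_; _∪_ to _∪ₛ_)
  open import Data.Fin.Subset.Properties using (x∈p∪q⁻; x∈⁅y⁆⇒x≡y)
  open import Data.List.Membership.Propositional using (_∈_)
  open import Data.List.Membership.Propositional.Properties
    using (∈-++⁺ˡ; ∈-++⁺ʳ; ∈-map⁺; ∈-map⁻; ∈-allFin; ∈-filter⁺; ∈-filter⁻; ∈-cartesianProduct⁺)
  open import Data.List.Relation.Binary.Disjoint.Propositional using (Disjoint)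
  open import Relation.Unary using (Pred; Decidable; _∪_; ｛_｝) renaming (_⊆_ to _⇒_)

  _≟ⱽ_ : DecidableEquality (Vertex np nr)
  _≟ⱽ_ = ≡-dec _≟ᶠ_ _≟ᶠ_

  open Linkages _≟ⱽ_ public

  allVertices : List (Vertex np nr)
  allVertices = map inj₁ (allFin np) ++ map inj₂ (allFin nr)

  ∈-allVertices : ∀ v → v ∈ allVertices
  ∈-allVertices (inj₁ p) = ∈-++⁺ˡ (∈-map⁺ inj₁ (∈-allFin p))
  ∈-allVertices (inj₂ r) = ∈-++⁺ʳ (map inj₁ (allFin np)) (∈-map⁺ inj₂ (∈-allFin r))

  allVertices-unique : Unique allVertices
  allVertices-unique = Unique.++⁺ (Unique.map⁺ inj₁-injective (Unique.allFin⁺ np))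
    (Unique.map⁺ inj₂-injective (Unique.allFin⁺ nr)) players-not-resources
    where
    players-not-resources : Disjoint (map inj₁ (allFin np)) (map inj₂ (allFin nr))
    players-not-resources (v∈₁ , v∈₂) with ∈-map⁻ inj₁ v∈₁ | ∈-map⁻ inj₂ v∈₂
    ... | _ , _ , refl | _ , _ , ()

  open Finite allVertices ∈-allVertices allVertices-unique public

  arc? : ∀ u v → Dec (Arc G M u v)
  arc? (inj₁ p) (inj₂ r) = map′ (λ (g , m) → fwd g m) (λ { (fwd g m) → g , m }) ((G p r ≟ᵇ true) ×-dec (M p r ≟ᵇ false))
  arc? (inj₂ r) (inj₁ p) = map′ (λ (g , m) → bwd g m) (λ { (bwd g m) → g , m }) ((G p r ≟ᵇ true) ×-dec (M p r ≟ᵇ true))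
  arc? (inj₁ _) (inj₁ _) = no λ ()
  arc? (inj₂ _) (inj₂ _) = no λ ()

  IsArc : Pred (Vertex np nr × Vertex np nr) 0ℓ
  IsArc (u , v) = Arc G M u v

  isArc? : Decidable IsArc
  isArc? (u , v) = arc? u v

  -- G_M with its arcs listed explicitly, as Menger's theorem is proved by induction on the arc list.
  arcs : Edges
  arcs = filter isArc? (cartesianProduct allVertices allVertices)

  Arc⇒∈arcs : ∀ {u v} → Arc G M u v → (u , v) ∈ arcs
  Arc⇒∈arcs = ∈-filter⁺ isArc? (∈-cartesianProduct⁺ (∈-allVertices _) (∈-allVertices _))

  ∈arcs⇒Arc : ∀ {u v} → (u , v) ∈ arcs → Arc G M u v
  ∈arcs⇒Arc = proj₂ ∘ ∈-filter⁻ isArc? {xs = cartesianProduct allVertices allVertices}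

  toWalk : ∀ {u v} → Walkᴹ G M u v → Walk arcs u v
  toWalk (stopᴹ v)   = stop v
  toWalk (stepᴹ a w) = Arc⇒∈arcs a ◅ toWalk w

  fromWalk : ∀ {u v} → Walk arcs u v → Walkᴹ G M u v
  fromWalk (stop v) = stopᴹ v
  fromWalk (e ◅ w)  = stepᴹ (∈arcs⇒Arc e) (fromWalk w)

  verts-toWalk : ∀ {u v} (w : Walkᴹ G M u v) → verts (toWalk w) ≡ vertsᴹ w
  verts-toWalk (stopᴹ v)   = refl
  verts-toWalk (stepᴹ a w) = cong (_ ∷_) (verts-toWalk w)

  verts-fromWalk : ∀ {u v} (w : Walk arcs u v) → vertsᴹ (fromWalk w) ≡ verts w
  verts-fromWalk (stop v) = refl
  verts-fromWalk (e ◅ w)  = cong (_ ∷_) (verts-fromWalk w)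

  Players : Subset np → Pred (Vertex np nr) 0ℓ
  Players X (inj₁ p) = p ∈ₛ X
  Players X (inj₂ _) = ⊥

  module _ {S X : Subset np} where

    toPath : STPath G M S X → Path arcs (Players S) (Players X)
    toPath (stpath s t s∈S t∈X w) = mkPath s∈S t∈X (toWalk w)

    fromPath : Path arcs (Players S) (Players X) → STPath G M S X
    fromPath (mkPath {inj₁ s} {inj₁ t} s∈S t∈X w) = stpath s t s∈S t∈X (fromWalk w)

    vertices-toPath : ∀ P → Path.vertices (toPath P) ≡ pathVerts P
    vertices-toPath (stpath s t s∈S t∈X w) = verts-toWalk w

    pathVerts-fromPath : ∀ P → pathVerts (fromPath P) ≡ Path.vertices P
    pathVerts-fromPath (mkPath {inj₁ s} {inj₁ t} s∈S t∈X w) = verts-fromWalk w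

    fromPaths : (Ps : List (STPath G M S X)) → DisjointPaths Ps → Linkage arcs (Players S) (Players X) (length Ps)
    fromPaths Ps disj =
      subst (Linkage _ _ _) (length-map toPath Ps) (Linkage-fromList (map toPath Ps) (subst Unique same-vertices disj))
      where
      same-vertices : concatMap pathVerts Ps ≡ concatMap Path.vertices (map toPath Ps)
      same-vertices = trans (sym (concatMap-cong vertices-toPath Ps)) (sym (concatMap-map Path.vertices toPath Ps))

    toPaths : ∀ {k} → Linkage arcs (Players S) (Players X) k →
              Σ[ Ps ∈ List (STPath G M S X) ] DisjointPaths Ps × length Ps ≡ k
    toPaths L =
      let Ps , uniq , len = Linkage-toList L
      in map fromPath Ps , subst Unique (same-vertices Ps) uniq , trans (length-map fromPath Ps) len
      where
      same-vertices : ∀ Ps → concatMap Path.vertices Ps ≡ concatMap pathVerts (map fromPath Ps)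
      same-vertices Ps = trans (sym (concatMap-cong pathVerts-fromPath Ps)) (sym (concatMap-map pathVerts fromPath Ps))

    fm-linkage : ∀ {k} → IsFM G M S X k → Linkage arcs (Players S) (Players X) k
    fm-linkage ((Ps , disj , len) , _) = subst (Linkage _ _ _) len (fromPaths Ps disj)

    fm-bound : ∀ {k} → IsFM G M S X k → LinkagesAtMost arcs (Players S) (Players X) k
    fm-bound (_ , maximal) L = let Ps , disj , len = toPaths L in subst (_≤ _) len (maximal Ps disj)

  fm-exists : ∀ S X → ¬ ¬ ∃ (IsFM G M S X)
  fm-exists S X = do
    k , L , bound ← maximum-linkage arcs (Players S) (Players X)
    pure (k , toPaths L , λ Ps disj → bound (fromPaths Ps disj))

  Players-⊆ : ∀ {X Y} → X ⊆ₛ Y → Players X ⇒ Players Y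
  Players-⊆ X⊆Y {inj₁ p} p∈X = X⊆Y p∈X

  Players-∪ : ∀ {X Y} → Players (X ∪ₛ Y) ⇒ Players X ∪ Players Y
  Players-∪ {X} {Y} {inj₁ p} p∈X∪Y = x∈p∪q⁻ X Y p∈X∪Y

  Players-⁅⁆ : ∀ {p} → Players ⁅ p ⁆ ⇒ ｛ inj₁ p ｝
  Players-⁅⁆ {x = inj₁ q} q∈⁅p⁆ = cong inj₁ (sym (x∈⁅y⁆⇒x≡y _ q∈⁅p⁆))

open import Data.Fin.Subset using (Subset; _∈_; _⊆_; _∪_; ⁅_⁆)
open import Data.Fin.Subset.Properties using (x∈p∪q⁺)
open import Data.Nat using (_≟_)
open import Defs using (IsMaximumMatching; Unmatched)

claim5 : ∀ {np nr : ℕ} (G : Graph np nr) (M : EdgeSet np nr) →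
    IsMaximumMatching G M →
    (S T : Subset np) → (∀ s → s ∈ S → Unmatched M s) → (p : Fin np) →
    (∀ a b → IsFM G M S (T ∪ ⁅ p ⁆) a → IsFM G M S T b → a ≡ suc b) →
    ∀ (T' : Subset np) → T' ⊆ T →
    ∀ c d → IsFM G M S (T' ∪ ⁅ p ⁆) c → IsFM G M S T' d → c ≡ suc d
claim5 G M _ S T _ p hyp T' T'⊆T c d fc fd = decidable-stable (c ≟ suc d) do
    a , fa ← fm-exists S (T ∪ ⁅ p ⁆)
    b , fb ← fm-exists S T
    pure (≤-antisym c≤1+d (1+d≤c (hyp a b fa fb) (submodularity fa fb)))
  where
  open AlternatingDigraph G M

  c≤1+d : c ≤ suc d
  c≤1+d = linkage-addTarget (fm-bound fd) (retarget (Sum.map₂ Players-⁅⁆ ∘ Players-∪) (fm-linkage fc))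

  submodularity : ∀ {a b} → IsFM G M S (T ∪ ⁅ p ⁆) a → IsFM G M S T b → a + d ≤ c + b
  submodularity fa fb = linkage-submodular (fm-bound fc) (fm-bound fb)
    (retarget (Sum.[ inj₂ , inj₁ ∘ Players-⊆ (x∈p∪q⁺ ∘ inj₂) ] ∘ Players-∪) (fm-linkage fa))
    (retarget (λ t∈T' → Players-⊆ (x∈p∪q⁺ ∘ inj₁) t∈T' , Players-⊆ T'⊆T t∈T') (fm-linkage fd))

  1+d≤c : ∀ {a b} → a ≡ suc b → a + d ≤ c + b → suc d ≤ c
  1+d≤c {b = b} refl 1+b+d≤c+b = +-cancelʳ-≤ b (suc d) c (subst (_≤ c + b) (cong suc (+-comm b d)) 1+b+d≤c+b)
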